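{- For every ordered graph $H$ and every $\epsilon>0$ there exists $\delta>0$ with the following property. For every ordered graph $G$ on $n$ vertices that does not contain $H$ as an induced ordered subgraph, there exists a subset $U\subset V(G)$ with $|U|\ge \delta n$ such that either $\Delta(G[U])\le \epsilon|U|$ or $\Delta(\overline{G}[U])\le \epsilon|U|$.
   Context: An ordered graph is a graph together with a total ordering $\prec$ of its vertex set. An ordered graph $H$ is an induced ordered subgraph of an ordered graph $G$ if there is an order-preserving injection $V(H)\to V(G)$ mapping edges to edges and non-edges to non-edges. $G[U]$ is the subgraph induced by $U$, $\overline{G}$ is the complement of $G$, and $\Delta(\cdot)$ denotes maximum degree.
   Formalization: The parameter ε ranges over the positive rationals, and the δ asserted to exist is taken in the positive rationals as well. -}

module Defs where

open import Data.Nat using (ℕ)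
open import Data.Bool using (Bool; true; false; not; _∧_)
open import Data.Fin using (Fin; _<_; _≟_)
open import Data.Fin.Subset using (Subset; _∈_; _∩_; ∣_∣)
open import Data.Vec using (tabulate)
open import Data.Integer using (+_)
open import Data.Rational using (ℚ; _/_; _*_; _≤_)
open import Relation.Nullary.Decidable using (⌊_⌋)
open import Relation.Binary.PropositionalEquality using (_≡_)

-- An ordered graph on n vertices: vertex set Fin n with its natural order,
-- adjacency a symmetric irreflexive Bool-valued relation.
record OGraph (n : ℕ) : Set where
  field
    adj   : Fin n → Fin n → Bool
    sym   : ∀ i j → adj i j ≡ adj j i
    irref : ∀ i → adj i i ≡ false
open OGraph public

complement : ∀ {n} → OGraph n → OGraph n
complement {n} G = record
  { adj = λ i j → not (adj G i j) ∧ not ⌊ i ≟ j ⌋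
  ; sym = symc
  ; irref = irc }
  where
  open import Relation.Binary.PropositionalEquality using (refl; cong₂; cong)
  open import Relation.Nullary using (yes; no)
  symc : ∀ i j → (not (adj G i j) ∧ not ⌊ i ≟ j ⌋) ≡ (not (adj G j i) ∧ not ⌊ j ≟ i ⌋)
  symc i j with i ≟ j | j ≟ i
  ... | yes _ | yes _ = cong₂ _∧_ (cong not (OGraph.sym G i j)) refl
  ... | no _  | no _  = cong₂ _∧_ (cong not (OGraph.sym G i j)) refl
  ... | yes refl | no q with q refl
  ... | ()
  symc i j | no p | yes refl with p refl
  ... | ()
  irc : ∀ i → (not (adj G i i) ∧ not ⌊ i ≟ i ⌋) ≡ false
  irc i with i ≟ i
  ... | yes _ = Data.Bool.Properties.∧-zeroʳ (not (adj G i i))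
    where import Data.Bool.Properties
  ... | no p with p refl
  ... | ()

_≤ind_ : ∀ {k n} → OGraph k → OGraph n → Set
_≤ind_ {k} {n} H G =
  Σ (Fin k → Fin n) λ f →
    (∀ i j → i < j → f i < f j) × (∀ i j → adj H i j ≡ adj G (f i) (f j))
  where open import Data.Product using (Σ; _×_)

nbhd : ∀ {n} → OGraph n → Fin n → Subset n
nbhd G v = tabulate (adj G v)

degIn : ∀ {n} → OGraph n → Subset n → Fin n → ℕ
degIn G U v = ∣ U ∩ nbhd G v ∣

ℕtoℚ : ℕ → ℚ
ℕtoℚ m = (+ m) / 1

MaxDegLe : ∀ {n} → OGraph n → Subset n → ℚ → Set
MaxDegLe G U ε = ∀ v → v ∈ U → ℕtoℚ (degIn G U v) ≤ ε * ℕtoℚ ∣ U ∣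

-- Cut the vertex set into |H| consecutive blocks and embed H greedily, one vertex per block: a
-- vertex of the first block is usable if in every later block it has many neighbours, or many
-- non-neighbours, as H prescribes, and the later blocks are then shrunk to those. Since H is not
-- induced in G, at some stage no vertex is usable, and we get sets C and D such that every vertex
-- of C sees less than a 1/p fraction of D in some colour τ (edges or non-edges). Double counting
-- and Markov's inequality turn this into m vertices X and a set Y, half as large as D, in which
-- every vertex has at most 2m/p τ-neighbours in X. Recursing into Y gives a sparse set of some
-- colour; if that colour is τ, the half of X that is sparse towards it is added. Each such round
-- adds between m/2 and m vertices while raising the degree bound by only 4m/p, so after 2t rounds
-- some colour has been chosen t times, yielding about t·m vertices whose degrees in that colour
-- are at most 2m. Taking m proportional to n gives δ.

module Submission where

open import Defs hiding (sym)
open import Data.Bool using (Bool; true; false; not; _∧_; _∨_; if_then_else_)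
open import Data.Bool.Properties using (∧-distribʳ-∨) renaming (_≟_ to _≟ᵇ_)
open import Data.Empty using (⊥; ⊥-elim)
open import Data.Fin using (Fin; zero; suc) renaming (_<_ to _<ᶠ_)
open import Data.Fin.Properties using (any?; all?; ¬∀⟶∃¬) renaming (<-cmp to <-cmpᶠ)
open import Data.Fin.Subset using (Subset; ∣_∣; _∩_; _∈_)
import Data.Integer as ℤ
import Data.Integer.Properties as ℤ
open import Data.Nat
open import Data.Nat.Coprimality using (Coprime; 1-coprimeTo)
open import Data.Nat.DivMod using (_/_; m≡m%n+[m/n]*n; m%n<n; m/n*n≤m; m≥n⇒m/n>0)
open import Data.Nat.Properties
open import Algebra.Properties.Semiring.Sum +-*-semiring
  using (sum; sum-cong-≋; ∑-distrib-+; ∑-comm; *-distribˡ-sum; *-distribʳ-sum)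
open import Data.Nat.Tactic.RingSolver using (solve-∀)
open import Data.Product using (Σ; ∃; ∃₂; _×_; _,_)
open import Data.Rational as ℚ using (ℚ; mkℚ; Positive)
import Data.Rational.Properties as ℚ
import Data.Rational.Unnormalised as ℚᵘ
import Data.Rational.Unnormalised.Properties as ℚᵘ
open import Data.Sum as Sum using (_⊎_; inj₁; inj₂; [_,_]′)
open import Data.Vec using (tabulate; _∷_)
open import Data.Vec.Properties using (lookup∘tabulate; []=⇒lookup)
open import Function using (_∘_)
open import Relation.Binary using (tri<; tri≈; tri>)
open import Relation.Binary.PropositionalEquality
open import Relation.Nullary using (Dec; yes; no; ¬_)
open import Relation.Nullary.Decidable using (_×-dec_; map′)
open import Relation.Nullary.Reflects using (ofʸ; ofⁿ)

private variable
  n : ℕ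

-- Finite sums and counting

∑-cong : {f g : Fin n → ℕ} → (∀ i → f i ≡ g i) → sum f ≡ sum g
∑-cong = sum-cong-≋

∑-const : ∀ c → sum {n} (λ _ → c) ≡ n * c
∑-const {zero} c = refl
∑-const {suc n} c = cong (c +_) (∑-const {n} c)

∑-mono-≤ : {f g : Fin n → ℕ} → (∀ i → f i ≤ g i) → sum f ≤ sum g
∑-mono-≤ {zero} f≤g = z≤n
∑-mono-≤ {suc n} f≤g = +-mono-≤ (f≤g zero) (∑-mono-≤ (f≤g ∘ suc))

∑-mono-< : {f g : Fin (suc n) → ℕ} → (∀ i → f i < g i) → sum f < sum g
∑-mono-< f<g = +-mono-<-≤ (f<g zero) (∑-mono-≤ (<⇒≤ ∘ f<g ∘ suc))

term≤∑ : (f : Fin n → ℕ) (i : Fin n) → f i ≤ sum f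
term≤∑ f zero = m≤m+n _ _
term≤∑ f (suc i) = ≤-trans (term≤∑ (f ∘ suc) i) (m≤n+m _ (f zero))

averaging : ∀ {ℓ} (a : Fin (suc ℓ) → ℕ) {N} → N ≤ sum a → ∃ λ j → N ≤ suc ℓ * a j
averaging {ℓ} a {N} N≤∑a with any? (λ j → N ≤? suc ℓ * a j)
... | yes found = found
... | no none = ⊥-elim (<⇒≱ ℓ∑a<ℓN (*-monoʳ-≤ (suc ℓ) N≤∑a))
  where
  ℓ∑a<ℓN : suc ℓ * sum a < suc ℓ * N
  ℓ∑a<ℓN = begin-strict
    suc ℓ * sum a              ≡⟨ *-distribˡ-sum (suc ℓ) a ⟩
    sum (λ j → suc ℓ * a j)    <⟨ ∑-mono-< (λ j → ≰⇒> (λ N≤ → none (j , N≤))) ⟩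
    sum {suc ℓ} (λ _ → N)      ≡⟨ ∑-const {suc ℓ} N ⟩
    suc ℓ * N                  ∎
    where open ≤-Reasoning

Sub : ℕ → Set
Sub n = Fin n → Bool

-- A record rather than S x ≡ true, so that unification can recover S from x ∈ₛ S.
record _∈ₛ_ (x : Fin n) (S : Sub n) : Set where
  constructor in-set
  field holds : S x ≡ true
open _∈ₛ_

_⊆ₛ_ : Sub n → Sub n → Set
S ⊆ₛ T = ∀ {x} → x ∈ₛ S → x ∈ₛ T

Disjoint : Sub n → Sub n → Set
Disjoint S T = ∀ {x} → x ∈ₛ S → x ∈ₛ T → ⊥

∅ₛ fullₛ : Sub n
∅ₛ _ = false
fullₛ _ = true

_∩ₛ_ _∪ₛ_ _∖ₛ_ : Sub n → Sub n → Sub n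
(S ∩ₛ T) x = S x ∧ T x
(S ∪ₛ T) x = S x ∨ T x
(S ∖ₛ T) x = S x ∧ not (T x)

atMost : (Fin n → ℕ) → ℕ → Sub n
atMost f β x = f x ≤ᵇ β

infixr 7 _∩ₛ_
infixr 6 _∪ₛ_ _∖ₛ_
infix 4 _∈ₛ_ _⊆ₛ_

_∈ₛ?_ : (x : Fin n) (S : Sub n) → Dec (x ∈ₛ S)
x ∈ₛ? S = map′ in-set holds (S x ≟ᵇ true)

∧≡true⁻ˡ : ∀ a {b} → a ∧ b ≡ true → a ≡ true
∧≡true⁻ˡ true _ = refl

∧≡true⁻ʳ : ∀ a {b} → a ∧ b ≡ true → b ≡ true
∧≡true⁻ʳ true b≡true = b≡true

∈-∩⁻ˡ : {S T : Sub n} → S ∩ₛ T ⊆ₛ S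
∈-∩⁻ˡ {S = S} {x = x} (in-set x∈) = in-set (∧≡true⁻ˡ (S x) x∈)

∈-∩⁻ʳ : {S T : Sub n} → S ∩ₛ T ⊆ₛ T
∈-∩⁻ʳ {S = S} {x = x} (in-set x∈) = in-set (∧≡true⁻ʳ (S x) x∈)

∈-∩⁺ : {S T : Sub n} {x : Fin n} → x ∈ₛ S → x ∈ₛ T → x ∈ₛ S ∩ₛ T
∈-∩⁺ (in-set x∈S) (in-set x∈T) = in-set (cong₂ _∧_ x∈S x∈T)

∈-∪⁻ : {S T : Sub n} {x : Fin n} → x ∈ₛ S ∪ₛ T → x ∈ₛ S ⊎ x ∈ₛ T
∈-∪⁻ {S = S} {x = x} (in-set x∈) with S x in x∈S
... | true = inj₁ (in-set x∈S)
... | false = inj₂ (in-set x∈)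

∈-∖⁻ : {S T : Sub n} → S ∖ₛ T ⊆ₛ S
∈-∖⁻ {S = S} {x = x} (in-set x∈) = in-set (∧≡true⁻ˡ (S x) x∈)

∉-∖ : {S T : Sub n} {x : Fin n} → x ∈ₛ S ∖ₛ T → ¬ x ∈ₛ T
∉-∖ {S = S} {x = x} (in-set x∈) (in-set x∈T)
  with () ← subst (λ b → not b ≡ true) x∈T (∧≡true⁻ʳ (S x) x∈)

∈-atMost⁻ : {f : Fin n → ℕ} {β : ℕ} {x : Fin n} → x ∈ₛ atMost f β → f x ≤ β
∈-atMost⁻ {f = f} {β} {x} (in-set x∈) with f x ≤ᵇ β | ≤ᵇ-reflects-≤ (f x) β
... | true | ofʸ fx≤β = fx≤β

∈-atMost⁺ : {f : Fin n → ℕ} {β : ℕ} {x : Fin n} → f x ≤ β → x ∈ₛ atMost f β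
∈-atMost⁺ {f = f} {β} {x} fx≤β with f x ≤ᵇ β in fx≤ᵇβ | ≤ᵇ-reflects-≤ (f x) β
... | true | _ = in-set fx≤ᵇβ
... | false | ofⁿ fx≰β = ⊥-elim (fx≰β fx≤β)

χ : Bool → ℕ
χ true = 1
χ false = 0

∣_∣ₛ : Sub n → ℕ
∣ S ∣ₛ = sum (χ ∘ S)

∣∅ₛ∣ : ∣ ∅ₛ {n} ∣ₛ ≡ 0
∣∅ₛ∣ {zero} = refl
∣∅ₛ∣ {suc n} = ∣∅ₛ∣ {n}

∣fullₛ∣ : ∣ fullₛ {n} ∣ₛ ≡ n
∣fullₛ∣ {zero} = refl
∣fullₛ∣ {suc n} = cong suc (∣fullₛ∣ {n})

∣∣ₛ-cong : {S T : Sub n} → (∀ x → S x ≡ T x) → ∣ S ∣ₛ ≡ ∣ T ∣ₛ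
∣∣ₛ-cong S≗T = ∑-cong (cong χ ∘ S≗T)

∣∣ₛ-mono : {S T : Sub n} → S ⊆ₛ T → ∣ S ∣ₛ ≤ ∣ T ∣ₛ
∣∣ₛ-mono {S = S} {T} S⊆T = ∑-mono-≤ χ-mono
  where
  χ-mono : ∀ x → χ (S x) ≤ χ (T x)
  χ-mono x with S x in x∈S
  ... | false = z≤n
  ... | true rewrite holds (S⊆T (in-set x∈S)) = ≤-refl

∣∣ₛ-∪ : {S T : Sub n} → Disjoint S T → ∣ S ∪ₛ T ∣ₛ ≡ ∣ S ∣ₛ + ∣ T ∣ₛ
∣∣ₛ-∪ {S = S} {T} S∩T=∅ = trans (∑-cong χ-∨) (∑-distrib-+ (χ ∘ S) (χ ∘ T))
  where
  χ-∨ : ∀ x → χ (S x ∨ T x) ≡ χ (S x) + χ (T x)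
  χ-∨ x with S x in x∈S | T x in x∈T
  ... | false | _ = refl
  ... | true | false = refl
  ... | true | true = ⊥-elim (S∩T=∅ (in-set x∈S) (in-set x∈T))

∣∣ₛ-partition : (S T : Sub n) → ∣ S ∣ₛ ≡ ∣ S ∩ₛ T ∣ₛ + ∣ S ∖ₛ T ∣ₛ
∣∣ₛ-partition S T = trans (∑-cong χ-split) (∑-distrib-+ (χ ∘ (S ∩ₛ T)) (χ ∘ (S ∖ₛ T)))
  where
  χ-split : ∀ x → χ (S x) ≡ χ (S x ∧ T x) + χ (S x ∧ not (T x))
  χ-split x with S x | T x
  ... | false | _ = refl
  ... | true | false = refl
  ... | true | true = refl

nonempty : {S : Sub n} → 0 < ∣ S ∣ₛ → ∃ (_∈ₛ S)
nonempty {suc n} {S} 0<∣S∣ with S zero in 0∈S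
... | true = zero , in-set 0∈S
... | false with x , in-set x∈S ← nonempty {S = S ∘ suc} 0<∣S∣ = suc x , in-set x∈S

∑∈ : Sub n → (Fin n → ℕ) → ℕ
∑∈ S f = sum (λ x → χ (S x) * f x)

syntax ∑∈ S (λ x → e) = ∑[ x ∈ S ] e

∑∈-*ˡ : (S : Sub n) (c : ℕ) (f : Fin n → ℕ) → ∑[ x ∈ S ] (c * f x) ≡ c * ∑[ x ∈ S ] f x
∑∈-*ˡ S c f = trans (∑-cong χ*c*f) (sym (*-distribˡ-sum c (λ x → χ (S x) * f x)))
  where
  χ*c*f : ∀ x → χ (S x) * (c * f x) ≡ c * (χ (S x) * f x)
  χ*c*f x = trans (sym (*-assoc (χ (S x)) c (f x)))
    (trans (cong (_* f x) (*-comm (χ (S x)) c)) (*-assoc c _ _))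

∑∈-≤ : (S : Sub n) (f : Fin n → ℕ) {β : ℕ} → (∀ {x} → x ∈ₛ S → f x ≤ β) →
  ∑[ x ∈ S ] f x ≤ ∣ S ∣ₛ * β
∑∈-≤ S f {β} f≤β = begin
  ∑[ x ∈ S ] f x           ≤⟨ ∑-mono-≤ χ*f≤χ*β ⟩
  sum (λ x → χ (S x) * β)  ≡⟨ *-distribʳ-sum β (χ ∘ S) ⟨
  ∣ S ∣ₛ * β               ∎
  where
  open ≤-Reasoning
  χ*f≤χ*β : ∀ x → χ (S x) * f x ≤ χ (S x) * β
  χ*f≤χ*β x with S x in x∈S
  ... | true = *-monoʳ-≤ 1 (f≤β (in-set x∈S))
  ... | false = z≤n

markov : (S : Sub n) (f : Fin n → ℕ) (β : ℕ) →
  suc β * ∣ S ∖ₛ atMost f β ∣ₛ ≤ ∑[ x ∈ S ] f x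
markov S f β = begin
  suc β * ∣ S ∖ₛ atMost f β ∣ₛ                   ≡⟨ *-distribˡ-sum (suc β) (χ ∘ (S ∖ₛ atMost f β)) ⟩
  sum (λ x → suc β * χ (S x ∧ not (f x ≤ᵇ β)))  ≤⟨ ∑-mono-≤ (λ x → pointwise (S x) (f x)) ⟩
  ∑[ x ∈ S ] f x                                 ∎
  where
  open ≤-Reasoning
  pointwise : ∀ s v → suc β * χ (s ∧ not (v ≤ᵇ β)) ≤ χ s * v
  pointwise false v = ≤-reflexive (*-zeroʳ (suc β))
  pointwise true v with v ≤ᵇ β | ≤ᵇ-reflects-≤ v β
  ... | true | _ = ≤-trans (≤-reflexive (*-zeroʳ (suc β))) z≤n
  ... | false | ofⁿ v≰β = subst₂ _≤_ (sym (*-identityʳ (suc β))) (sym (+-identityʳ v)) (≰⇒> v≰β)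

markov-half : (S : Sub n) (f : Fin n → ℕ) (w : ℕ) → ∑[ x ∈ S ] f x ≤ w * ∣ S ∣ₛ →
  ∣ S ∣ₛ ≤ 2 * ∣ S ∩ₛ atMost f (2 * w) ∣ₛ
markov-half S f w ∑f≤w∣S∣ = half (∣∣ₛ-partition S (atMost f (2 * w)))
  (≤-trans (markov S f (2 * w)) ∑f≤w∣S∣)
  where
  half : ∀ {s g b} → s ≡ g + b → suc (2 * w) * b ≤ w * s → s ≤ 2 * g
  half {g = g} {b} refl bound =
    subst (g + b ≤_) (cong (g +_) (sym (+-identityʳ g))) (+-monoʳ-≤ g (cancel w wb+b≤wg))
    where
    lhs : ∀ w b → suc (2 * w) * b ≡ (w * b + b) + w * b
    lhs = solve-∀
    rhs : ∀ w g b → w * (g + b) ≡ w * g + w * b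
    rhs = solve-∀
    wb+b≤wg : w * b + b ≤ w * g
    wb+b≤wg = +-cancelʳ-≤ (w * b) _ _ (subst₂ _≤_ (lhs w b) (rhs w g b) bound)
    cancel : ∀ w → w * b + b ≤ w * g → b ≤ g
    cancel zero b≤0 = ≤-trans b≤0 z≤n
    cancel w@(suc _) wb+b≤wg = *-cancelˡ-≤ w (≤-trans (m≤m+n (w * b) b) wb+b≤wg)

pigeonhole : ∀ {ℓ} (S : Sub n) (F : Fin (suc ℓ) → Sub n) → (∀ {x} → x ∈ₛ S → ∃ λ j → x ∈ₛ F j) →
  ∃ λ j → ∣ S ∣ₛ ≤ suc ℓ * ∣ S ∩ₛ F j ∣ₛ
pigeonhole S F cover = averaging (λ j → ∣ S ∩ₛ F j ∣ₛ) union-bound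
  where
  covered : ∀ x → χ (S x) ≤ sum (λ j → χ (S x ∧ F j x))
  covered x with S x in x∈S
  ... | false = z≤n
  ... | true with j , in-set x∈Fj ← cover (in-set x∈S) =
    subst (λ b → χ b ≤ sum (λ j → χ (F j x))) x∈Fj (term≤∑ (λ j → χ (F j x)) j)
  union-bound : ∣ S ∣ₛ ≤ sum (λ j → ∣ S ∩ₛ F j ∣ₛ)
  union-bound = subst (∣ S ∣ₛ ≤_) (∑-comm (λ x j → χ (S x ∧ F j x))) (∑-mono-≤ covered)

deg : (Fin n → Fin n → Bool) → Fin n → Sub n → ℕ
deg R x T = ∣ T ∩ₛ R x ∣ₛ

double-counting : {R : Fin n → Fin n → Bool} → (∀ x y → R x y ≡ R y x) → (S T : Sub n) →
  ∑[ x ∈ S ] deg R x T ≡ ∑[ y ∈ T ] deg R y S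
double-counting {R = R} R-sym S T = begin
  sum (λ x → χ (S x) * sum (λ y → χ (T y ∧ R x y)))  ≡⟨ ∑-cong (λ x → *-distribˡ-sum (χ (S x)) (λ y → χ (T y ∧ R x y))) ⟩
  sum (λ x → sum (λ y → χ (S x) * χ (T y ∧ R x y)))  ≡⟨ ∑-comm (λ x y → χ (S x) * χ (T y ∧ R x y)) ⟩
  sum (λ y → sum (λ x → χ (S x) * χ (T y ∧ R x y)))  ≡⟨ ∑-cong (λ y → ∑-cong (λ x → swap (S x) (T y) (R-sym x y))) ⟩
  sum (λ y → sum (λ x → χ (T y) * χ (S x ∧ R y x)))  ≡⟨ ∑-cong (λ y → *-distribˡ-sum (χ (T y)) (λ x → χ (S x ∧ R y x))) ⟨
  sum (λ y → χ (T y) * sum (λ x → χ (S x ∧ R y x)))  ∎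
  where
  open ≡-Reasoning
  swap : ∀ s t {r r′} → r ≡ r′ → χ s * χ (t ∧ r) ≡ χ t * χ (s ∧ r′)
  swap false false refl = refl
  swap false true refl = refl
  swap true false refl = refl
  swap true true refl = refl

deg-∪ : (R : Fin n → Fin n → Bool) (x : Fin n) {S T : Sub n} → Disjoint S T →
  deg R x (S ∪ₛ T) ≡ deg R x S + deg R x T
deg-∪ R x {S} {T} S∩T=∅ = trans (∣∣ₛ-cong (λ y → ∧-distribʳ-∨ (R x y) (S y) (T y)))
  (∣∣ₛ-∪ (λ y∈S y∈T → S∩T=∅ (∈-∩⁻ˡ y∈S) (∈-∩⁻ˡ y∈T)))

deg-mono : (R : Fin n → Fin n → Bool) (x : Fin n) {S T : Sub n} → S ⊆ₛ T → deg R x S ≤ deg R x T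
deg-mono R x S⊆T = ∣∣ₛ-mono (λ y∈ → ∈-∩⁺ (S⊆T (∈-∩⁻ˡ y∈)) (∈-∩⁻ʳ y∈))

deg≤∣∣ₛ : (R : Fin n → Fin n → Bool) (x : Fin n) (S : Sub n) → deg R x S ≤ ∣ S ∣ₛ
deg≤∣∣ₛ R x S = ∣∣ₛ-mono {S = S ∩ₛ R x} ∈-∩⁻ˡ

-- Initial segments and consecutive blocks

take : ℕ → Sub n → Sub n
take zero S x = false
take (suc s) S zero = S zero
take (suc s) S (suc x) = take (if S zero then s else suc s) (S ∘ suc) x

take-⊆ : ∀ s (S : Sub n) → take s S ⊆ₛ S
take-⊆ s S {x} (in-set x∈) = in-set (go s S x x∈)
  where
  go : ∀ {n} s (S : Sub n) x → take s S x ≡ true → S x ≡ true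
  go (suc s) S zero x∈ = x∈
  go (suc s) S (suc x) x∈ with S zero
  ... | true = go s (S ∘ suc) x x∈
  ... | false = go (suc s) (S ∘ suc) x x∈

∣take∣ : ∀ s (S : Sub n) → s ≤ ∣ S ∣ₛ → ∣ take s S ∣ₛ ≡ s
∣take∣ {n} zero S _ = ∣∅ₛ∣ {n}
∣take∣ {suc n} (suc s) S s<∣S∣ with S zero
... | true = cong suc (∣take∣ s (S ∘ suc) (s≤s⁻¹ s<∣S∣))
... | false = ∣take∣ (suc s) (S ∘ suc) s<∣S∣

take-< : ∀ s (S : Sub n) {x y} → x ∈ₛ take s S → y ∈ₛ S ∖ₛ take s S → x <ᶠ y
take-< s S {x} {y} (in-set x∈) y∈ = go s S x y x∈ (holds (∈-∖⁻ {S = S} y∈)) (∉-∖ {S = S} y∈ ∘ in-set)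
  where
  go : ∀ {n} s (S : Sub n) x y → take s S x ≡ true → S y ≡ true → ¬ take s S y ≡ true → x <ᶠ y
  go (suc s) S zero zero _ y∈S y∉ = ⊥-elim (y∉ y∈S)
  go (suc s) S zero (suc y) _ _ _ = s≤s z≤n
  go (suc s) S (suc x) zero _ y∈S y∉ = ⊥-elim (y∉ y∈S)
  go (suc s) S (suc x) (suc y) x∈ y∈S y∉ with S zero
  ... | true = s≤s (go s (S ∘ suc) x y x∈ y∈S y∉)
  ... | false = s≤s (go (suc s) (S ∘ suc) x y x∈ y∈S y∉)

Ordered : ∀ {ℓ} → (Fin ℓ → Sub n) → Set
Ordered B = ∀ {a b} → a <ᶠ b → ∀ {x y} → x ∈ₛ B a → y ∈ₛ B b → x <ᶠ y

blocks : ∀ k → ℕ → Sub n → Fin k → Sub n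
blocks (suc k) s W zero = take s W
blocks (suc k) s W (suc a) = blocks k s (W ∖ₛ take s W) a

blocks-⊆ : ∀ k s (W : Sub n) a → blocks k s W a ⊆ₛ W
blocks-⊆ (suc k) s W zero = take-⊆ s W
blocks-⊆ (suc k) s W (suc a) = ∈-∖⁻ ∘ blocks-⊆ k s (W ∖ₛ take s W) a

∣∖take∣ : ∀ s (W : Sub n) → s ≤ ∣ W ∣ₛ → ∣ W ∖ₛ take s W ∣ₛ + s ≡ ∣ W ∣ₛ
∣∖take∣ s W s≤∣W∣ = begin
  ∣ W ∖ₛ take s W ∣ₛ + s                   ≡⟨ +-comm _ s ⟩
  s + ∣ W ∖ₛ take s W ∣ₛ                   ≡⟨ cong (_+ ∣ W ∖ₛ take s W ∣ₛ) ∣W∩take∣ ⟨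
  ∣ W ∩ₛ take s W ∣ₛ + ∣ W ∖ₛ take s W ∣ₛ  ≡⟨ ∣∣ₛ-partition W (take s W) ⟨
  ∣ W ∣ₛ                                   ∎
  where
  open ≡-Reasoning
  W∩take : ∀ x → W x ∧ take s W x ≡ take s W x
  W∩take x with take s W x in x∈
  ... | true rewrite holds (take-⊆ s W (in-set x∈)) = refl
  ... | false with W x
  ...   | true = refl
  ...   | false = refl
  ∣W∩take∣ : ∣ W ∩ₛ take s W ∣ₛ ≡ s
  ∣W∩take∣ = trans (∣∣ₛ-cong W∩take) (∣take∣ s W s≤∣W∣)

∣blocks∣ : ∀ k s (W : Sub n) a → k * s ≤ ∣ W ∣ₛ → ∣ blocks k s W a ∣ₛ ≡ s
∣blocks∣ (suc k) s W zero ks≤∣W∣ = ∣take∣ s W (≤-trans (m≤m+n s _) ks≤∣W∣)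
∣blocks∣ (suc k) s W (suc a) ks≤∣W∣ = ∣blocks∣ k s (W ∖ₛ take s W) a
  (+-cancelʳ-≤ s _ _ (subst₂ _≤_ (+-comm s (k * s))
    (sym (∣∖take∣ s W (≤-trans (m≤m+n s _) ks≤∣W∣))) ks≤∣W∣))

blocks-ordered : ∀ k s (W : Sub n) → Ordered (blocks k s W)
blocks-ordered (suc k) s W {zero} {suc b} _ x∈ y∈ = take-< s W x∈ (blocks-⊆ k s (W ∖ₛ take s W) b y∈)
blocks-ordered (suc k) s W {suc a} {suc b} (s≤s a<b) = blocks-ordered k s (W ∖ₛ take s W) a<b

-- m * need K p s vertices suffice for s rounds of SparseSet-in-some-colour: a round splits off
-- K blocks of L * p ^ K vertices, L = K * m + 2 * (m * need K p (s - 1)), and passes at least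
-- L / 2 of them on to the next round.
need : ℕ → ℕ → ℕ → ℕ
need K p zero = 0
need K p (suc s) = K * ((K + 2 * need K p s) * p ^ K)

-- The greedy embedding

colour : Bool → OGraph n → OGraph n
colour true G = G
colour false G = complement G

adj-colour : ∀ τ (G : OGraph n) {x y} → adj (colour τ G) x y ≡ true → adj G x y ≡ τ
adj-colour true G xy∈ = xy∈
adj-colour false G {x} {y} xy∈ with adj G x y | xy∈
... | false | _ = refl

module _ (G : OGraph n) where

  deg⟨_⟩ : Bool → Fin n → Sub n → ℕ
  deg⟨ τ ⟩ = deg (adj (colour τ G))

  double-counting⟨_⟩ : ∀ τ (S T : Sub n) → ∑[ x ∈ S ] deg⟨ τ ⟩ x T ≡ ∑[ y ∈ T ] deg⟨ τ ⟩ y S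
  double-counting⟨ τ ⟩ = double-counting (OGraph.sym (colour τ G))

  record Embedding {ℓ} (P : Fin ℓ → Fin ℓ → Bool) (B : Fin ℓ → Sub n) : Set where
    field
      f : Fin ℓ → Fin n
      f∈B : ∀ a → f a ∈ₛ B a
      f-adj : ∀ {a b} → a <ᶠ b → adj G (f a) (f b) ≡ P a b

  P-tail : ∀ {ℓ} → (Fin (suc ℓ) → Fin (suc ℓ) → Bool) → Fin ℓ → Fin ℓ → Bool
  P-tail P a b = P (suc a) (suc b)

  restrict : ∀ {ℓ} → (Fin (suc ℓ) → Fin (suc ℓ) → Bool) → (Fin (suc ℓ) → Sub n) → Fin n → Fin ℓ → Sub n
  restrict P B v j = B (suc j) ∩ₛ adj (colour (P zero (suc j)) G) v

  Embedding-extend : ∀ {ℓ} (P : Fin (suc ℓ) → Fin (suc ℓ) → Bool) (B : Fin (suc ℓ) → Sub n) {v} →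
    v ∈ₛ B zero → Embedding (P-tail P) (restrict P B v) → Embedding P B
  Embedding-extend {ℓ} P B {v} v∈B₀ e = record { f = f′ ; f∈B = f′∈B ; f-adj = f′-adj }
    where
    open Embedding e
    f′ : Fin (suc ℓ) → Fin n
    f′ zero = v
    f′ (suc a) = f a
    f′∈B : ∀ a → f′ a ∈ₛ B a
    f′∈B zero = v∈B₀
    f′∈B (suc a) = ∈-∩⁻ˡ {S = B (suc a)} (f∈B a)
    f′-adj : ∀ {a b} → a <ᶠ b → adj G (f′ a) (f′ b) ≡ P a b
    f′-adj {zero} {suc b} _ = adj-colour (P zero (suc b)) G (holds (∈-∩⁻ʳ {S = B (suc b)} (f∈B b)))
    f′-adj {suc a} {suc b} (s≤s a<b) = f-adj a<b

  module _ (p K : ℕ) {{_ : NonZero p}} where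

    Rich : Bool → Fin n → Sub n → Set
    Rich τ v D = ∣ D ∣ₛ ≤ p * deg⟨ τ ⟩ v D

    poor : Bool → Sub n → Sub n
    poor τ D = atMost (λ v → suc (p * deg⟨ τ ⟩ v D)) ∣ D ∣ₛ

    ∈-poor⁺ : ∀ {τ v} {D : Sub n} → ¬ Rich τ v D → v ∈ₛ poor τ D
    ∈-poor⁺ ¬rich = ∈-atMost⁺ (≰⇒> ¬rich)

    ∈-poor⁻ : ∀ {τ v} {D : Sub n} → v ∈ₛ poor τ D → p * deg⟨ τ ⟩ v D < ∣ D ∣ₛ
    ∈-poor⁻ {τ} {D = D} = ∈-atMost⁻ {f = λ v → suc (p * deg⟨ τ ⟩ v D)}

    record SparsePair (L : ℕ) (W : Sub n) : Set where
      field
        τ : Bool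
        C D : Sub n
        C⊆W : C ⊆ₛ W
        D⊆W : D ⊆ₛ W
        C∩D=∅ : Disjoint C D
        L≤K∣C∣ : L ≤ K * ∣ C ∣ₛ
        L≤∣D∣ : L ≤ ∣ D ∣ₛ
        C-sparse : ∀ {x} → x ∈ₛ C → p * deg⟨ τ ⟩ x D < ∣ D ∣ₛ

    Rich⇒restrict-large : ∀ {L ℓ τ v} {D : Sub n} → L * p ^ suc ℓ ≤ ∣ D ∣ₛ → Rich τ v D → L * p ^ ℓ ≤ deg⟨ τ ⟩ v D
    Rich⇒restrict-large {L} {ℓ} D-big v-rich = *-cancelˡ-≤ p (≤-trans (≤-reflexive p*L*p^ℓ) (≤-trans D-big v-rich))
      where
      p*L*p^ℓ : p * (L * p ^ ℓ) ≡ L * p ^ suc ℓ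
      p*L*p^ℓ = trans (sym (*-assoc p L _)) (trans (cong (_* p ^ ℓ) (*-comm p L)) (*-assoc L p _))

    L≤L*p^ : ∀ L ℓ → L ≤ L * p ^ ℓ
    L≤L*p^ L ℓ = m≤m*n L (p ^ ℓ) {{m^n≢0 p ℓ}}

    poor-vertices⇒SparsePair : ∀ {ℓ} → suc ℓ ≤ K → (P : Fin (suc (suc ℓ)) → Fin (suc (suc ℓ)) → Bool)
      (B : Fin (suc (suc ℓ)) → Sub n) {W : Sub n} {L : ℕ} → (∀ a → B a ⊆ₛ W) → Ordered B →
      L ≤ ∣ B zero ∣ₛ → (∀ j → L ≤ ∣ B (suc j) ∣ₛ) →
      (∀ {v} → v ∈ₛ B zero → ∃ λ j → ¬ Rich (P zero (suc j)) v (B (suc j))) → SparsePair L W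
    poor-vertices⇒SparsePair ℓ<K P B B⊆W ord L≤∣B₀∣ L≤∣B∣ has-poor-block
      with j , ∣B₀∣≤ ← pigeonhole (B zero) (λ j → poor (P zero (suc j)) (B (suc j)))
             (λ v∈B₀ → let (j , ¬rich) = has-poor-block v∈B₀ in j , ∈-poor⁺ {P zero (suc j)} ¬rich) =
      record
        { τ = P zero (suc j)
        ; C = B zero ∩ₛ poor (P zero (suc j)) (B (suc j))
        ; D = B (suc j)
        ; C⊆W = B⊆W zero ∘ ∈-∩⁻ˡ
        ; D⊆W = B⊆W (suc j)
        ; C∩D=∅ = λ x∈C x∈D → <-irrefl refl (ord (s≤s z≤n) (∈-∩⁻ˡ x∈C) x∈D)
        ; L≤K∣C∣ = ≤-trans L≤∣B₀∣ (≤-trans ∣B₀∣≤ (*-monoˡ-≤ _ ℓ<K))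
        ; L≤∣D∣ = L≤∣B∣ j
        ; C-sparse = ∈-poor⁻ {P zero (suc j)} ∘ ∈-∩⁻ʳ {S = B zero}
        }

    embed-or-sparse : ∀ ℓ → ℓ ≤ K → (P : Fin ℓ → Fin ℓ → Bool) (B : Fin ℓ → Sub n) {W : Sub n} {L : ℕ} →
      0 < L → (∀ a → B a ⊆ₛ W) → Ordered B → (∀ a → L * p ^ ℓ ≤ ∣ B a ∣ₛ) →
      Embedding P B ⊎ SparsePair L W
    embed-or-sparse zero _ P B _ _ _ _ = inj₁ (record { f = λ () ; f∈B = λ () ; f-adj = λ { {()} } })
    embed-or-sparse (suc ℓ) ℓ≤K P B {W} {L} L>0 B⊆W ord big
      with any? (λ v → (v ∈ₛ? B zero) ×-dec
                       all? (λ j → ∣ B (suc j) ∣ₛ ≤? p * deg⟨ P zero (suc j) ⟩ v (B (suc j))))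
    ... | yes (v , v∈B₀ , v-rich) =
      Sum.map₁ (Embedding-extend P B v∈B₀)
        (embed-or-sparse ℓ (<⇒≤ ℓ≤K) (P-tail P) (restrict P B v) L>0
          (λ j → B⊆W (suc j) ∘ ∈-∩⁻ˡ)
          (λ a<b x∈ y∈ → ord (s≤s a<b) (∈-∩⁻ˡ x∈) (∈-∩⁻ˡ y∈))
          (λ j → Rich⇒restrict-large {L} {ℓ} {P zero (suc j)} {v} (big (suc j)) (v-rich j)))
    embed-or-sparse (suc zero) ℓ≤K P B {L = L} L>0 B⊆W ord big | no no-rich-vertex =
      let (v , v∈B₀) = nonempty (≤-trans L>0 (≤-trans (L≤L*p^ L 1) (big zero)))
      in ⊥-elim (no-rich-vertex (v , v∈B₀ , λ ()))
    embed-or-sparse (suc (suc ℓ)) ℓ≤K P B {L = L} L>0 B⊆W ord big | no no-rich-vertex =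
      inj₂ (poor-vertices⇒SparsePair (<⇒≤ ℓ≤K) P B B⊆W ord
        (≤-trans (L≤L*p^ L (2 + ℓ)) (big zero)) (λ j → ≤-trans (L≤L*p^ L (2 + ℓ)) (big (suc j)))
        (λ {v} v∈B₀ → ¬∀⟶∃¬ _ _ (λ j → ∣ B (suc j) ∣ₛ ≤? p * deg⟨ P zero (suc j) ⟩ v (B (suc j)))
                        (λ v-rich → no-rich-vertex (v , v∈B₀ , v-rich))))

  embedding⇒≤ind : ∀ {k} (H : OGraph k) {B : Fin k → Sub n} → Ordered B → Embedding (adj H) B → H ≤ind G
  embedding⇒≤ind H {B} ord e = f , f-mono , f-adj′
    where
    open Embedding e
    f-mono : ∀ i j → i <ᶠ j → f i <ᶠ f j
    f-mono i j i<j = ord i<j (f∈B i) (f∈B j)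
    f-adj′ : ∀ i j → adj H i j ≡ adj G (f i) (f j)
    f-adj′ i j with <-cmpᶠ i j
    ... | tri< i<j _ _ = sym (f-adj i<j)
    ... | tri≈ _ refl _ = trans (OGraph.irref H i) (sym (OGraph.irref G (f i)))
    ... | tri> _ _ j<i = trans (OGraph.sym H i j) (trans (sym (f-adj j<i)) (OGraph.sym G (f j) (f i)))

  -- Growing a sparse colour class

  ∑∈-deg-≤ : ∀ τ c (S T : Sub n) {β} → (∀ {y} → y ∈ₛ T → c * deg⟨ τ ⟩ y S ≤ β) →
    ∑[ x ∈ S ] (c * deg⟨ τ ⟩ x T) ≤ ∣ T ∣ₛ * β
  ∑∈-deg-≤ τ c S T {β} bound = begin
    ∑[ x ∈ S ] (c * deg⟨ τ ⟩ x T)  ≡⟨ ∑∈-*ˡ S c (λ x → deg⟨ τ ⟩ x T) ⟩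
    c * ∑[ x ∈ S ] deg⟨ τ ⟩ x T    ≡⟨ cong (c *_) (double-counting⟨ τ ⟩ S T) ⟩
    c * ∑[ y ∈ T ] deg⟨ τ ⟩ y S    ≡⟨ ∑∈-*ˡ T c (λ y → deg⟨ τ ⟩ y S) ⟨
    ∑[ y ∈ T ] (c * deg⟨ τ ⟩ y S)  ≤⟨ ∑∈-≤ T (λ y → c * deg⟨ τ ⟩ y S) bound ⟩
    ∣ T ∣ₛ * β                     ∎
    where open ≤-Reasoning

  module _ (p : ℕ) {{_ : NonZero p}} (m : ℕ) where

    record ThinPair (τ : Bool) (L : ℕ) (W : Sub n) : Set where
      field
        X Y : Sub n
        X⊆W : X ⊆ₛ W
        Y⊆W : Y ⊆ₛ W
        X∩Y=∅ : Disjoint X Y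
        ∣X∣≡m : ∣ X ∣ₛ ≡ m
        L≤2∣Y∣ : L ≤ 2 * ∣ Y ∣ₛ
        Y-thin : ∀ {y} → y ∈ₛ Y → p * deg⟨ τ ⟩ y X ≤ 2 * m

    SparsePair⇒ThinPair : ∀ {k L W} → suc k * m ≤ L → (sp : SparsePair p (suc k) L W) → ThinPair (SparsePair.τ sp) L W
    SparsePair⇒ThinPair {k} Km≤L sp = record
      { X = X
      ; Y = Y
      ; X⊆W = C⊆W ∘ take-⊆ m C
      ; Y⊆W = D⊆W ∘ ∈-∩⁻ˡ
      ; X∩Y=∅ = λ x∈X x∈Y → C∩D=∅ (take-⊆ m C x∈X) (∈-∩⁻ˡ {S = D} x∈Y)
      ; ∣X∣≡m = ∣X∣≡m
      ; L≤2∣Y∣ = ≤-trans L≤∣D∣ (markov-half D f m ∑f≤m∣D∣)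
      ; Y-thin = ∈-atMost⁻ {f = f} ∘ ∈-∩⁻ʳ {S = D}
      }
      where
      open SparsePair sp
      X : Sub n
      X = take m C
      ∣X∣≡m : ∣ X ∣ₛ ≡ m
      ∣X∣≡m = ∣take∣ m C (*-cancelˡ-≤ (suc k) (≤-trans Km≤L L≤K∣C∣))
      f : Fin n → ℕ
      f y = p * deg⟨ τ ⟩ y X
      Y : Sub n
      Y = D ∩ₛ atMost f (2 * m)
      ∑f≤m∣D∣ : ∑[ y ∈ D ] f y ≤ m * ∣ D ∣ₛ
      ∑f≤m∣D∣ = subst (λ s → ∑[ y ∈ D ] f y ≤ s * ∣ D ∣ₛ) ∣X∣≡m
        (∑∈-deg-≤ τ p D X (λ x∈X → <⇒≤ (C-sparse (take-⊆ m C x∈X))))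

    H-free⇒ThinPair : ∀ {k} (H : OGraph (suc k)) → ¬ H ≤ind G → ∀ {L W} → 0 < m → suc k * m ≤ L →
      suc k * (L * p ^ suc k) ≤ ∣ W ∣ₛ → ∃ λ τ → ThinPair τ L W
    H-free⇒ThinPair {k} H H⊄G {L} {W} m>0 Km≤L W-big
      with embed-or-sparse p (suc k) (suc k) ≤-refl (adj H) (blocks (suc k) s W)
             (≤-trans m>0 (≤-trans (m≤n*m m (suc k)) Km≤L))
             (blocks-⊆ (suc k) s W) (blocks-ordered (suc k) s W)
             (λ a → ≤-reflexive (sym (∣blocks∣ (suc k) s W a W-big)))
      where
      s : ℕ
      s = L * p ^ suc k
    ... | inj₁ e = ⊥-elim (H⊄G (embedding⇒≤ind H (blocks-ordered (suc k) _ W) e))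
    ... | inj₂ sp = SparsePair.τ sp , SparsePair⇒ThinPair Km≤L sp

    record SparseSet (τ : Bool) (c : ℕ) (W : Sub n) : Set where
      field
        Z : Sub n
        Z⊆W : Z ⊆ₛ W
        ∣Z∣≤cm : ∣ Z ∣ₛ ≤ c * m
        cm≤2∣Z∣ : c * m ≤ 2 * ∣ Z ∣ₛ
        Z-sparse : ∀ {u} → u ∈ₛ Z → p * deg⟨ τ ⟩ u Z ≤ (p + 4 * c) * m

    ∅-sparse : ∀ {τ W} → SparseSet τ 0 W
    ∅-sparse = record
      { Z = ∅ₛ ; Z⊆W = λ { (in-set ()) } ; ∣Z∣≤cm = ≤-reflexive (∣∅ₛ∣ {n}) ; cm≤2∣Z∣ = z≤n
      ; Z-sparse = λ { (in-set ()) } }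

    SparseSet-⊆ : ∀ {τ c V W} → V ⊆ₛ W → SparseSet τ c V → SparseSet τ c W
    SparseSet-⊆ V⊆W s = record { SparseSet s ; Z⊆W = V⊆W ∘ SparseSet.Z⊆W s }

    ∪-sparse : ∀ {τ c} {Z X′ : Sub n} → Disjoint Z X′ → ∣ Z ∣ₛ ≤ c * m → ∣ X′ ∣ₛ ≤ m →
      (∀ {u} → u ∈ₛ Z → p * deg⟨ τ ⟩ u Z ≤ (p + 4 * c) * m) →
      (∀ {u} → u ∈ₛ Z → p * deg⟨ τ ⟩ u X′ ≤ 2 * m) →
      (∀ {u} → u ∈ₛ X′ → p * deg⟨ τ ⟩ u Z ≤ 2 * (2 * ∣ Z ∣ₛ)) →
      ∀ {u} → u ∈ₛ Z ∪ₛ X′ → p * deg⟨ τ ⟩ u (Z ∪ₛ X′) ≤ (p + 4 * suc c) * m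
    ∪-sparse {τ} {c} {Z} {X′} Z∩X′=∅ ∣Z∣≤cm ∣X′∣≤m Z-sparse Z→X′ X′→Z {u} u∈ = begin
      p * deg⟨ τ ⟩ u (Z ∪ₛ X′)              ≡⟨ cong (p *_) (deg-∪ (adj (colour τ G)) u Z∩X′=∅) ⟩
      p * (deg⟨ τ ⟩ u Z + deg⟨ τ ⟩ u X′)    ≡⟨ *-distribˡ-+ p (deg⟨ τ ⟩ u Z) (deg⟨ τ ⟩ u X′) ⟩
      p * deg⟨ τ ⟩ u Z + p * deg⟨ τ ⟩ u X′  ≤⟨ [ via-Z , via-X′ ]′ (∈-∪⁻ u∈) ⟩
      (p + 4 * c) * m + 4 * m               ≡⟨ next-level p c m ⟩
      (p + 4 * suc c) * m                   ∎
      where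
      open ≤-Reasoning
      next-level : ∀ p c m → (p + 4 * c) * m + 4 * m ≡ (p + 4 * suc c) * m
      next-level = solve-∀
      regroup : ∀ p c m → 2 * (2 * (c * m)) + p * m ≡ (p + 4 * c) * m
      regroup = solve-∀
      via-Z : u ∈ₛ Z → p * deg⟨ τ ⟩ u Z + p * deg⟨ τ ⟩ u X′ ≤ (p + 4 * c) * m + 4 * m
      via-Z u∈Z = +-mono-≤ (Z-sparse u∈Z) (≤-trans (Z→X′ u∈Z) (*-monoˡ-≤ m {2} {4} (s≤s (s≤s z≤n))))
      via-X′ : u ∈ₛ X′ → p * deg⟨ τ ⟩ u Z + p * deg⟨ τ ⟩ u X′ ≤ (p + 4 * c) * m + 4 * m
      via-X′ u∈X′ = begin
        p * deg⟨ τ ⟩ u Z + p * deg⟨ τ ⟩ u X′  ≤⟨ +-mono-≤ (≤-trans (X′→Z u∈X′) (*-monoʳ-≤ 2 (*-monoʳ-≤ 2 ∣Z∣≤cm)))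
                                                          (*-monoʳ-≤ p (≤-trans (deg≤∣∣ₛ (adj (colour τ G)) u X′) ∣X′∣≤m)) ⟩
        2 * (2 * (c * m)) + p * m             ≡⟨ regroup p c m ⟩
        (p + 4 * c) * m                       ≤⟨ m≤m+n _ (4 * m) ⟩
        (p + 4 * c) * m + 4 * m               ∎

    SparseSet-grow : ∀ {τ c L W} (tp : ThinPair τ L W) → SparseSet τ c (ThinPair.Y tp) → SparseSet τ (suc c) W
    SparseSet-grow {τ} {c} tp s = record
      { Z = Z ∪ₛ X′
      ; Z⊆W = [ Y⊆W ∘ Z⊆W , X⊆W ∘ ∈-∩⁻ˡ ]′ ∘ ∈-∪⁻
      ; ∣Z∣≤cm = subst₂ _≤_ (sym ∣Z∪X′∣) (+-comm (c * m) m) (+-mono-≤ ∣Z∣≤cm ∣X′∣≤m)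
      ; cm≤2∣Z∣ = subst₂ _≤_ (+-comm (c * m) m) (trans (sym (*-distribˡ-+ 2 ∣ Z ∣ₛ ∣ X′ ∣ₛ)) (cong (2 *_) (sym ∣Z∪X′∣)))
                    (+-mono-≤ cm≤2∣Z∣ m≤2∣X′∣)
      ; Z-sparse = ∪-sparse {τ} {c} Z∩X′=∅ ∣Z∣≤cm ∣X′∣≤m Z-sparse
          (λ u∈Z → ≤-trans (*-monoʳ-≤ p (deg-mono (adj (colour τ G)) _ ∈-∩⁻ˡ)) (Y-thin (Z⊆W u∈Z)))
          (∈-atMost⁻ {f = f} ∘ ∈-∩⁻ʳ {S = X})
      }
      where
      open ThinPair tp
      open SparseSet s
      f : Fin n → ℕ
      f x = p * deg⟨ τ ⟩ x Z
      X′ : Sub n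
      X′ = X ∩ₛ atMost f (2 * (2 * ∣ Z ∣ₛ))
      Z∩X′=∅ : Disjoint Z X′
      Z∩X′=∅ u∈Z u∈X′ = X∩Y=∅ (∈-∩⁻ˡ u∈X′) (Z⊆W u∈Z)
      ∣Z∪X′∣ : ∣ Z ∪ₛ X′ ∣ₛ ≡ ∣ Z ∣ₛ + ∣ X′ ∣ₛ
      ∣Z∪X′∣ = ∣∣ₛ-∪ Z∩X′=∅
      ∣X′∣≤m : ∣ X′ ∣ₛ ≤ m
      ∣X′∣≤m = subst (∣ X′ ∣ₛ ≤_) ∣X∣≡m (∣∣ₛ-mono {S = X′} ∈-∩⁻ˡ)
      ∑f≤2∣Z∣∣X∣ : ∑[ x ∈ X ] f x ≤ 2 * ∣ Z ∣ₛ * ∣ X ∣ₛ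
      ∑f≤2∣Z∣∣X∣ = ≤-trans (∑∈-deg-≤ τ p X Z (Y-thin ∘ Z⊆W))
        (≤-reflexive (trans (regroup ∣ Z ∣ₛ m) (cong (2 * ∣ Z ∣ₛ *_) (sym ∣X∣≡m))))
        where
        regroup : ∀ z m → z * (2 * m) ≡ 2 * z * m
        regroup = solve-∀
      m≤2∣X′∣ : m ≤ 2 * ∣ X′ ∣ₛ
      m≤2∣X′∣ = subst (_≤ 2 * ∣ X′ ∣ₛ) ∣X∣≡m (markov-half X f (2 * ∣ Z ∣ₛ) ∑f≤2∣Z∣∣X∣)

    module _ {k} (H : OGraph (suc k)) (H⊄G : ¬ H ≤ind G) (m>0 : 0 < m) where

      need≤∣Y∣ : ∀ {τ s W} (tp : ThinPair τ (suc k * m + 2 * (m * need (suc k) p s)) W) →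
        m * need (suc k) p s ≤ ∣ ThinPair.Y tp ∣ₛ
      need≤∣Y∣ tp = *-cancelˡ-≤ 2 (≤-trans (m≤n+m _ (suc k * m)) (ThinPair.L≤2∣Y∣ tp))

      SparseSet-in-some-colour : ∀ a b {W} → m * need (suc k) p (a + b) ≤ ∣ W ∣ₛ →
        SparseSet true a W ⊎ SparseSet false b W
      SparseSet-in-some-colour zero b _ = inj₁ ∅-sparse
      SparseSet-in-some-colour (suc a) zero _ = inj₂ ∅-sparse
      SparseSet-in-some-colour (suc a) (suc b) {W} W-big
        with H-free⇒ThinPair H H⊄G m>0 (m≤m+n (suc k * m) _)
               (≤-trans (≤-reflexive (need-suc (suc k) m N (p ^ suc k))) W-big)
        where
        N : ℕ
        N = need (suc k) p (a + suc b)
        need-suc : ∀ K m N P → K * ((K * m + 2 * (m * N)) * P) ≡ m * (K * ((K + 2 * N) * P))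
        need-suc = solve-∀
      ... | true , tp = Sum.map (SparseSet-grow tp) (SparseSet-⊆ (ThinPair.Y⊆W tp))
                          (SparseSet-in-some-colour a (suc b) (need≤∣Y∣ {s = a + suc b} tp))
      ... | false , tp = Sum.map (SparseSet-⊆ (ThinPair.Y⊆W tp)) (SparseSet-grow tp)
                          (SparseSet-in-some-colour (suc a) b
                            (subst (λ s → m * need (suc k) p s ≤ ∣ ThinPair.Y tp ∣ₛ) (+-suc a b)
                              (need≤∣Y∣ {s = a + suc b} tp)))

∣tabulate∣ : (S : Sub n) → ∣ tabulate S ∣ ≡ ∣ S ∣ₛ
∣tabulate∣ {zero} S = refl
∣tabulate∣ {suc n} S with S zero
... | true = cong suc (∣tabulate∣ (S ∘ suc))
... | false = ∣tabulate∣ (S ∘ suc)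

tabulate-∩ : (S T : Sub n) → tabulate S ∩ tabulate T ≡ tabulate (S ∩ₛ T)
tabulate-∩ {zero} S T = refl
tabulate-∩ {suc n} S T = cong (S zero ∧ T zero ∷_) (tabulate-∩ (S ∘ suc) (T ∘ suc))

∈-tabulate⁻ : (S : Sub n) {x : Fin n} → x ∈ tabulate S → x ∈ₛ S
∈-tabulate⁻ S {x} x∈ = in-set (trans (sym (lookup∘tabulate S x)) ([]=⇒lookup x∈))

degIn-tabulate : (G : OGraph n) (S : Sub n) (v : Fin n) → degIn G (tabulate S) v ≡ deg (adj G) v S
degIn-tabulate G S v = trans (cong ∣_∣ (tabulate-∩ S (adj G v))) (∣tabulate∣ (S ∩ₛ adj G v))

toℚᵘ-ℕtoℚ : ∀ d → ℚ.toℚᵘ (ℕtoℚ d) ℚᵘ.≃ ℚᵘ.mkℚᵘ (ℤ.+ d) 0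
toℚᵘ-ℕtoℚ d = ℚ.toℚᵘ-fromℚᵘ (ℚᵘ.mkℚᵘ (ℤ.+ d) 0)

toℚᵘ-*ℕtoℚ : ∀ a b .(c : Coprime a (suc b)) u →
  ℚ.toℚᵘ (mkℚ (ℤ.+ a) b c ℚ.* ℕtoℚ u) ℚᵘ.≃ ℚᵘ.mkℚᵘ (ℤ.+ a) b ℚᵘ.* ℚᵘ.mkℚᵘ (ℤ.+ u) 0
toℚᵘ-*ℕtoℚ a b c u = ℚᵘ.≃-trans (ℚ.toℚᵘ-homo-* (mkℚ (ℤ.+ a) b c) (ℕtoℚ u))
  (ℚᵘ.*-congˡ {ℚᵘ.mkℚᵘ (ℤ.+ a) b} (toℚᵘ-ℕtoℚ u))

+[a*u]*1 : ∀ a u → ℤ.+ (a * u) ≡ (ℤ.+ a ℤ.* ℤ.+ u) ℤ.* ℤ.+ 1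
+[a*u]*1 a u = trans (cong ℤ.+_ (sym (*-identityʳ (a * u))))
  (trans (ℤ.pos-* (a * u) 1) (cong (ℤ._* ℤ.+ 1) (ℤ.pos-* a u)))

+d*+[1+b] : ∀ d b → ℤ.+ (suc b * d) ≡ ℤ.+ d ℤ.* ℤ.+ (suc b * 1)
+d*+[1+b] d b = trans (cong ℤ.+_ (trans (*-comm (suc b) d) (cong (d *_) (sym (*-identityʳ (suc b))))))
  (ℤ.pos-* d (suc b * 1))

ℕtoℚ-≤-* : ∀ a b .(c : Coprime a (suc b)) d u → suc b * d ≤ a * u →
  ℕtoℚ d ℚ.≤ mkℚ (ℤ.+ a) b c ℚ.* ℕtoℚ u
ℕtoℚ-≤-* a b c d u bd≤au = ℚ.toℚᵘ-cancel-≤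
  (ℚᵘ.≤-respˡ-≃ (ℚᵘ.≃-sym (toℚᵘ-ℕtoℚ d)) (ℚᵘ.≤-respʳ-≃ (ℚᵘ.≃-sym (toℚᵘ-*ℕtoℚ a b c u))
    (ℚᵘ.*≤* (subst₂ ℤ._≤_ (+d*+[1+b] d b) (+[a*u]*1 a u) (ℤ.+≤+ bd≤au)))))

*ℕtoℚ-≤-ℕtoℚ : ∀ a b .(c : Coprime a (suc b)) d u → a * d ≤ suc b * u →
  mkℚ (ℤ.+ a) b c ℚ.* ℕtoℚ d ℚ.≤ ℕtoℚ u
*ℕtoℚ-≤-ℕtoℚ a b c d u ad≤bu = ℚ.toℚᵘ-cancel-≤
  (ℚᵘ.≤-respʳ-≃ (ℚᵘ.≃-sym (toℚᵘ-ℕtoℚ u)) (ℚᵘ.≤-respˡ-≃ (ℚᵘ.≃-sym (toℚᵘ-*ℕtoℚ a b c d))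
    (ℚᵘ.*≤* (subst₂ ℤ._≤_ (+[a*u]*1 a d) (+d*+[1+b] u b) (ℤ.+≤+ ad≤bu)))))

SparseIn : (G : OGraph n) → Bool → ℕ → Sub n → Set
SparseIn G τ t Z = ∀ {u} → u ∈ₛ Z → t * deg (adj (colour τ G)) u Z ≤ 4 * ∣ Z ∣ₛ

first : Sub (suc n)
first zero = true
first (suc _) = false

singleton-sparse : (G : OGraph n) (τ : Bool) (t : ℕ) {N : ℕ} → n ≤ N → ∃ λ Z → n ≤ N * ∣ Z ∣ₛ × SparseIn G τ t Z
singleton-sparse {zero} G τ t _ = ∅ₛ , z≤n , λ { (in-set ()) }
singleton-sparse {suc n} G τ t {N} n≤N = first , subst (suc n ≤_) N≡N*∣first∣ n≤N , sparse
  where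
  N≡N*∣first∣ : N ≡ N * ∣ first {n} ∣ₛ
  N≡N*∣first∣ rewrite ∣∅ₛ∣ {n} = sym (*-identityʳ N)
  sparse : SparseIn G τ t first
  sparse {zero} _ rewrite OGraph.irref (colour τ G) zero | ∣∅ₛ∣ {n} = ≤-trans (≤-reflexive (*-zeroʳ t)) z≤n

size-bound : ∀ {n M m z t} → n < M + m * M → 0 < m → 0 < t → t * m ≤ 2 * z → n ≤ 4 * M * z
size-bound {n} {M} {m} {z} {t} n<M+mM m>0 t>0 tm≤2z = begin
  n                  ≤⟨ <⇒≤ n<M+mM ⟩
  M + m * M          ≤⟨ +-monoˡ-≤ (m * M) (m≤n*m M m {{>-nonZero m>0}}) ⟩
  m * M + m * M      ≡⟨ double m M ⟩
  2 * m * M          ≤⟨ *-monoˡ-≤ M (*-monoʳ-≤ 2 (≤-trans (m≤n*m m t {{>-nonZero t>0}}) tm≤2z)) ⟩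
  2 * (2 * z) * M    ≡⟨ regroup z M ⟩
  4 * M * z          ∎
  where
  open ≤-Reasoning
  double : ∀ m M → m * M + m * M ≡ 2 * m * M
  double = solve-∀
  regroup : ∀ z M → 2 * (2 * z) * M ≡ 4 * M * z
  regroup = solve-∀

module _ {k} (H : OGraph (suc k)) (t : ℕ) {{t≢0 : NonZero t}} where

  private instance
    4t≢0 : NonZero (4 * t)
    4t≢0 = m*n≢0 4 t

  -- The suc only makes the threshold a nonzero divisor.
  threshold : ℕ
  threshold = suc (need (suc k) (4 * t) (t + t))

  SparseSet⇒SparseIn : ∀ {n} {G : OGraph n} {m τ W} (s : SparseSet G (4 * t) m τ t W) →
    SparseIn G τ t (SparseSet.Z s)
  SparseSet⇒SparseIn {G = G} {m} {τ} s {u} u∈Z = begin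
    t * d                ≤⟨ *-cancelˡ-≤ 4 (subst (_≤ 4 * (2 * (t * m))) (*-assoc 4 t d)
                              (≤-trans (Z-sparse u∈Z) (≤-reflexive (double t m)))) ⟩
    2 * (t * m)          ≤⟨ *-monoʳ-≤ 2 cm≤2∣Z∣ ⟩
    2 * (2 * ∣ Z ∣ₛ)     ≡⟨ sym (*-assoc 2 2 ∣ Z ∣ₛ) ⟩
    4 * ∣ Z ∣ₛ           ∎
    where
    open SparseSet s
    open ≤-Reasoning
    d : ℕ
    d = deg (adj (colour τ G)) u Z
    double : ∀ t m → (4 * t + 4 * t) * m ≡ 4 * (2 * (t * m))
    double = solve-∀

  sparse-colour-class : ∀ {n} (G : OGraph n) → ¬ H ≤ind G →
    ∃₂ λ τ Z → n ≤ 4 * threshold * ∣ Z ∣ₛ × SparseIn G τ t Z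
  sparse-colour-class {n} G H⊄G with n <? threshold
  ... | yes n<M = true , singleton-sparse G true t (≤-trans (<⇒≤ n<M) (m≤n*m threshold 4))
  ... | no n≮M = [ (λ s → true , large s) , (λ s → false , large s) ]′
                   (SparseSet-in-some-colour G (4 * t) m H H⊄G m>0 t t mM≤n)
    where
    m : ℕ
    m = n / threshold
    m>0 : 0 < m
    m>0 = m≥n⇒m/n>0 (≮⇒≥ n≮M)
    mM≤n : m * need (suc k) (4 * t) (t + t) ≤ ∣ fullₛ {n} ∣ₛ
    mM≤n = subst (m * need (suc k) (4 * t) (t + t) ≤_) (sym (∣fullₛ∣ {n}))
             (≤-trans (*-monoʳ-≤ m (n≤1+n _)) (m/n*n≤m n threshold))
    n<M+mM : n < threshold + m * threshold
    n<M+mM = subst (_< threshold + m * threshold) (sym (m≡m%n+[m/n]*n n threshold))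
               (+-monoˡ-< (m * threshold) (m%n<n n threshold))
    large : ∀ {τ} (s : SparseSet G (4 * t) m τ t fullₛ) → ∃ λ Z → n ≤ 4 * threshold * ∣ Z ∣ₛ × SparseIn G τ t Z
    large s = SparseSet.Z s , size-bound n<M+mM m>0 (>-nonZero⁻¹ t) (SparseSet.cm≤2∣Z∣ s) , SparseSet⇒SparseIn s

MaxDegLe-tabulate : (G : OGraph n) (Z : Sub n) (a b : ℕ) .(c : Coprime a (suc b)) →
  (∀ {u} → u ∈ₛ Z → suc b * deg (adj G) u Z ≤ a * ∣ Z ∣ₛ) → MaxDegLe G (tabulate Z) (mkℚ (ℤ.+ a) b c)
MaxDegLe-tabulate G Z a b c bound v v∈ =
  subst₂ (λ d z → ℕtoℚ d ℚ.≤ mkℚ (ℤ.+ a) b c ℚ.* ℕtoℚ z) (sym (degIn-tabulate G Z v)) (sym (∣tabulate∣ Z))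
    (ℕtoℚ-≤-* a b c _ _ (bound (∈-tabulate⁻ Z v∈)))

size-tabulate : ∀ N (Z : Sub n) → n ≤ N * ∣ Z ∣ₛ → mkℚ (ℤ.+ 1) N (1-coprimeTo _) ℚ.* ℕtoℚ n ℚ.≤ ℕtoℚ ∣ tabulate Z ∣
size-tabulate {n} N Z n≤N∣Z∣ = subst (λ z → mkℚ (ℤ.+ 1) N (1-coprimeTo _) ℚ.* ℕtoℚ n ℚ.≤ ℕtoℚ z) (sym (∣tabulate∣ Z))
  (*ℕtoℚ-≤-ℕtoℚ 1 N (1-coprimeTo _) n ∣ Z ∣ₛ
    (≤-trans (≤-reflexive (*-identityˡ n)) (≤-trans n≤N∣Z∣ (m≤n+m (N * ∣ Z ∣ₛ) ∣ Z ∣ₛ))))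

SparseIn⇒MaxDegLe : (G : OGraph n) (τ : Bool) {Z : Sub n} (a b : ℕ) .(c : Coprime (suc a) (suc b)) →
  SparseIn G τ (4 * suc b) Z → MaxDegLe (colour τ G) (tabulate Z) (mkℚ (ℤ.+ suc a) b c)
SparseIn⇒MaxDegLe G τ {Z} a b c Z-sparse = MaxDegLe-tabulate (colour τ G) Z (suc a) b c (λ u∈Z →
  ≤-trans (*-cancelˡ-≤ 4 (subst (_≤ 4 * ∣ Z ∣ₛ) (*-assoc 4 (suc b) _) (Z-sparse u∈Z))) (m≤m+n ∣ Z ∣ₛ _))

MaxDegLe-colour : (G : OGraph n) (τ : Bool) {U : Subset n} {ε : ℚ} →
  MaxDegLe (colour τ G) U ε → MaxDegLe G U ε ⊎ MaxDegLe (complement G) U ε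
MaxDegLe-colour G true = inj₁
MaxDegLe-colour G false = inj₂

lemma3 : ∀ {k} (H : OGraph k) (ε : ℚ) → Positive ε →
    Σ ℚ λ δ → Positive δ ×
      (∀ {n} (G : OGraph n) → ¬ (H ≤ind G) →
        Σ (Subset n) λ U →
          (δ ℚ.* ℕtoℚ n ℚ.≤ ℕtoℚ ∣ U ∣) ×
          (MaxDegLe G U ε ⊎ MaxDegLe (complement G) U ε))
lemma3 {zero} H ε ε>0 = ε , ε>0 , λ G H⊄G → ⊥-elim (H⊄G ((λ ()) , (λ ()) , (λ ())))
lemma3 {suc k} H ε@(mkℚ (ℤ.+ suc a) b c) _ = δ , _ , λ G H⊄G →
  let τ , Z , n≤4M∣Z∣ , Z-sparse = sparse-colour-class H t G H⊄G
  in tabulate Z , size-tabulate (4 * M) Z n≤4M∣Z∣ , MaxDegLe-colour G τ {ε = ε} (SparseIn⇒MaxDegLe G τ a b c Z-sparse)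
  where
  t M : ℕ
  t = 4 * suc b
  M = threshold H t
  δ : ℚ
  δ = mkℚ (ℤ.+ 1) (4 * M) (1-coprimeTo _)
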